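{- For all $n\in\mathbb{N}$ and $\pi\in S_n'$, the sets $\{c_{\pi,i,j}:1\le j\le |C_{\pi,i}|\}$ for $1\le i\le\operatorname{sc}(\pi)$ are pairwise disjoint and their union is $[n]=\{1,\dots,n\}$.
   Context: A "permutation" may be any finite sequence of distinct integers. West's stack-sorting map $s$: read the input left to right with an initially empty stack; repeatedly, if the input is nonempty and either the stack is empty or the top of the stack is greater than the next input entry, push the next entry; otherwise pop the top of the stack and append it to the output; stop when input and stack are empty. $\operatorname{sc}(\pi)$ is the least $k\ge0$ with $s^k(\pi)$ increasing. $S_n'$ is the set of permutations of $\{0,1,\dots,n\}$ whose last entry is $0$. For $\pi\in S_n'$ and $1\le i\le\operatorname{sc}(\pi)$ let $\sigma=s^{i-1}(\pi)$. Let $c_{\pi,i,1}$ be the maximum of the entries of $\sigma$ strictly left of $0$. For $j\ge2$, as long as there is at least one entry of $\sigma$ strictly between $c_{\pi,i,j-1}$ and $0$, let $c_{\pi,i,j}$ be the maximum of the entries strictly between $c_{\pi,i,j-1}$ and $0$; otherwise the sequence stops. This gives $C_{\pi,i}=(c_{\pi,i,1},\dots,c_{\pi,i,|C_{\pi,i}|})$. -}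

module Defs where

open import Data.Nat using (ℕ; zero; suc; _<_; _≤_; _⊔_; _∸_; _<ᵇ_; _≡ᵇ_)
open import Data.Bool using (Bool; true; false; if_then_else_; not)
open import Data.List using (List; []; _∷_; _++_; [_]; upTo; length; takeWhileᵇ; foldr)
open import Data.List.Relation.Unary.Linked using (Linked)
open import Data.List.Relation.Binary.Permutation.Propositional using (_↭_)
open import Data.Product using (Σ; _×_)
open import Relation.Binary.PropositionalEquality using (_≡_)
open import Relation.Nullary using (¬_)
open import Function using (_∘_)

-- West's stack-sorting map, implemented literally as the stack algorithm.
-- Stacks are lists with the top at the head.  When the next input entry
-- x arrives, the stack is popped (to the output) while its top is < x
-- (for distinct entries, "not greater than x"), then x is pushed.

popWhileLess : ℕ → List ℕ → List ℕ → List ℕ × List ℕ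
popWhileLess x out [] = out Data.Product., []
popWhileLess x out (t ∷ st) =
  if t <ᵇ x then popWhileLess x (out ++ [ t ]) st else (out Data.Product., t ∷ st)

stackRun : List ℕ → List ℕ → List ℕ
stackRun [] st = st
stackRun (x ∷ xs) st with popWhileLess x [] st
... | out Data.Product., st' = out ++ stackRun xs (x ∷ st')

s : List ℕ → List ℕ
s π = stackRun π []

s^ : ℕ → List ℕ → List ℕ
s^ zero π = π
s^ (suc k) π = s (s^ k π)

Increasing : List ℕ → Set
Increasing = Linked _<_

IsSC : List ℕ → ℕ → Set
IsSC π k = Increasing (s^ k π) × (∀ j → j < k → ¬ Increasing (s^ j π))

S′ : ℕ → List ℕ → Set
S′ n π = (π ↭ upTo (suc n)) × Σ (List ℕ) (λ τ → π ≡ τ ++ [ 0 ])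

-- maximum of a list (only used on nonempty lists)
maxL : List ℕ → ℕ
maxL = foldr _⊔_ 0

after : ℕ → List ℕ → List ℕ
after m [] = []
after m (x ∷ xs) = if x ≡ᵇ m then xs else after m xs

leftOf0 : List ℕ → List ℕ
leftOf0 = takeWhileᵇ (λ x → not (x ≡ᵇ 0))

-- Given the list L of entries strictly left of 0, the sequence
-- c_1, c_2, … : c_1 = max L; c_j = max of the entries strictly between
-- c_{j-1} and 0, as long as there is one.  Fuel bounds the number of steps
-- (each step strictly shortens the list, so fuel = length L suffices).
chainF : ℕ → List ℕ → List ℕ
chainF zero L = []
chainF (suc f) [] = []
chainF (suc f) (x ∷ xs) = maxL (x ∷ xs) ∷ chainF f (after (maxL (x ∷ xs)) (x ∷ xs))

chain : List ℕ → List ℕ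
chain L = chainF (length L) L

C : List ℕ → ℕ → List ℕ
C π i = chain (leftOf0 (s^ (i ∸ 1) π))

{-# OPTIONS --safe #-}

-- Let L i be the entries left of 0 in s^i π.  Since 0 is smaller than every other
-- entry, reading 0 pops nothing and 0 is the next entry popped, so L (i + 1) is exactly
-- what the stack algorithm outputs while reading L i.  The entries still on the stack
-- at that moment are the right-to-left maxima of L i, and these are exactly the entries
-- of the chain C π (i + 1): its first element is the maximum of L i, and each next one
-- is the maximum of what follows the previous one.  Hence C π (i + 1) = L i ∖ L (i + 1);
-- as the L i shrink from L 0 = {1, …, n} to L k = [] (s^k π is increasing and 0 is its
-- least entry), the C π (i + 1) with i < k partition {1, …, n}.

module Submission where

open import Defs
open import Data.Nat using (ℕ; _≤_)
open import Data.List using (List)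
open import Data.List.Membership.Propositional using (_∈_)
open import Data.Product using (Σ; _×_)
open import Data.Empty using (⊥)
open import Relation.Binary.PropositionalEquality using (_≡_)
open import Relation.Nullary using (¬_)

open import Data.Bool using (true; false)
open import Data.Nat using (zero; suc; _<_; _<ᵇ_; _≡ᵇ_; _⊔_; z≤n; s≤s; _≤′_; ≤′-refl; ≤′-step)
open import Data.Nat.Properties
open import Data.Product using (∃; _,_; proj₁; proj₂)
open import Data.Sum using (_⊎_; inj₁; inj₂)
open import Data.List using ([]; _∷_; _++_; [_]; length)
open import Data.List.Properties using (++-assoc; ++-identityʳ; foldr-forcesᵇ)
open import Data.List.Membership.Propositional using (_∉_)
open import Data.List.Membership.Propositional.Properties
  using (∈-++⁺ˡ; ∈-++⁺ʳ; ∈-++⁻; ∈-upTo⁺; ∈-upTo⁻; foldr-selective)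
open import Data.List.Membership.DecPropositional _≟_ using (_∈?_)
open import Data.List.Relation.Unary.Any using (here; there; tail)
open import Data.List.Relation.Unary.All as All using (All; []; _∷_)
import Data.List.Relation.Unary.All.Properties as All
open import Data.List.Relation.Unary.AllPairs as AllPairs using (AllPairs; []; _∷_)
open import Data.List.Relation.Unary.Linked as Linked using ([]; [-]; _∷_)
open import Data.List.Relation.Unary.Linked.Properties using (Linked⇒All)
open import Data.List.Relation.Unary.Sorted.TotalOrder ≤-totalOrder using (Sorted)
open import Data.List.Relation.Unary.Unique.Propositional using (Unique)
open import Data.List.Relation.Unary.Unique.Propositional.Properties using (upTo⁺)
open import Data.List.Relation.Binary.Disjoint.Propositional using (Disjoint)
open import Data.List.Relation.Binary.Permutation.Propositional
  using (_↭_; ↭-refl; ↭-sym; ↭-trans; ↭⇒↭ₛ; module PermutationReasoning)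
open import Data.List.Relation.Binary.Permutation.Propositional.Properties
  using (∈-resp-↭; shift; shifts; ++⁺ˡ)
import Data.List.Relation.Binary.Permutation.Setoid.Properties as Setoid↭
open import Function using (_∘_; id)
open import Relation.Binary.Core using (Rel)
open import Relation.Binary.Definitions using (tri<; tri≈; tri>)
open import Relation.Binary.PropositionalEquality
  using (_≢_; refl; sym; trans; cong; subst; setoid; module ≡-Reasoning)
open import Relation.Nullary using (yes; no; contradiction)
open import Relation.Nullary.Reflects using (Reflects; ofʸ; ofⁿ; fromEquivalence)

-- Lists without repetitions

AllPairs-++⁻ : ∀ {a r} {A : Set a} {R : Rel A r} xs {ys} → AllPairs R (xs ++ ys) →
  AllPairs R xs × AllPairs R ys × All (λ x → All (R x) ys) xs
AllPairs-++⁻ []       rs        = [] , rs , []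
AllPairs-++⁻ (x ∷ xs) (r ∷ rs) =
  let rxs , rys , rxsys = AllPairs-++⁻ xs rs
  in All.++⁻ˡ xs r ∷ rxs , rys , All.++⁻ʳ xs r ∷ rxsys

Unique-++⁻ˡ : ∀ xs {ys : List ℕ} → Unique (xs ++ ys) → Unique xs
Unique-++⁻ˡ xs = proj₁ ∘ AllPairs-++⁻ xs

Unique-++⇒Disjoint : ∀ xs {ys : List ℕ} → Unique (xs ++ ys) → Disjoint xs ys
Unique-++⇒Disjoint xs u (x∈xs , x∈ys) =
  All.lookup (All.lookup (proj₂ (proj₂ (AllPairs-++⁻ xs u))) x∈xs) x∈ys refl

Unique-resp-↭ : ∀ {xs ys : List ℕ} → xs ↭ ys → Unique xs → Unique ys
Unique-resp-↭ = Setoid↭.Unique-resp-↭ (setoid ℕ) ∘ ↭⇒↭ₛ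

∈-++-↭⇒∉ˡ : ∀ {xs ys zs : List ℕ} {x} → Unique zs → xs ++ ys ↭ zs → x ∈ ys → x ∉ xs
∈-++-↭⇒∉ˡ {xs} u p x∈ys x∈xs =
  Unique-++⇒Disjoint xs (Unique-resp-↭ (↭-sym p) u) (x∈xs , x∈ys)

∈-++-↭⁺ʳ : ∀ {xs ys zs : List ℕ} {x} → xs ++ ys ↭ zs → x ∈ zs → x ∉ xs → x ∈ ys
∈-++-↭⁺ʳ {xs} p x∈zs x∉xs with ∈-++⁻ xs (∈-resp-↭ (↭-sym p) x∈zs)
... | inj₁ x∈xs = contradiction x∈xs x∉xs
... | inj₂ x∈ys = x∈ys

-- Right-to-left maxima

≡ᵇ-reflects-≡ : ∀ m n → Reflects (m ≡ n) (m ≡ᵇ n)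
≡ᵇ-reflects-≡ m n = fromEquivalence (≡ᵇ⇒≡ m n) (≡⇒≡ᵇ m n)

after-∷-≡ : ∀ x ys → after x (x ∷ ys) ≡ ys
after-∷-≡ x ys with x ≡ᵇ x | ≡ᵇ-reflects-≡ x x
... | true  | _       = refl
... | false | ofⁿ x≢x = contradiction refl x≢x

after-∷-≢ : ∀ {x y} ys → y ≢ x → after x (y ∷ ys) ≡ after x ys
after-∷-≢ {x} {y} ys y≢x with y ≡ᵇ x | ≡ᵇ-reflects-≡ y x
... | true  | ofʸ y≡x = contradiction y≡x y≢x
... | false | _       = refl

after-⊆ : ∀ {x z} L → z ∈ after x L → z ∈ L
after-⊆ {x} (y ∷ ys) z∈ with y ≡ᵇ x
... | true  = there z∈
... | false = there (after-⊆ ys z∈)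

length-after : ∀ x L → length (after x L) ≤ length L
length-after x []       = z≤n
length-after x (y ∷ ys) with y ≡ᵇ x
... | true  = n≤1+n (length ys)
... | false = m≤n⇒m≤1+n (length-after x ys)

length-after-∷ : ∀ x y ys → length (after x (y ∷ ys)) ≤ length ys
length-after-∷ x y ys with y ≡ᵇ x
... | true  = ≤-refl
... | false = length-after x ys

Unique-after : ∀ x {L} → Unique L → Unique (after x L)
Unique-after x {[]}     []      = []
Unique-after x {y ∷ ys} (_ ∷ u) with y ≡ᵇ x
... | true  = u
... | false = Unique-after x u

∈-after-either : ∀ {x m L} → x ∈ L → m ∈ L → x ≢ m → x ∈ after m L ⊎ m ∈ after x L
∈-after-either {x} {m} {y ∷ ys} x∈ m∈ x≢m with y ≡ᵇ m | ≡ᵇ-reflects-≡ y m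
... | true  | ofʸ refl = inj₁ (tail x≢m x∈)
... | false | ofⁿ y≢m with y ≡ᵇ x | ≡ᵇ-reflects-≡ y x
...   | true  | ofʸ refl = inj₂ (tail (y≢m ∘ sym) m∈)
...   | false | ofⁿ y≢x  = ∈-after-either (tail (y≢x ∘ sym) x∈) (tail (y≢m ∘ sym) m∈) x≢m

after-after : ∀ {x m L} → Unique L → x ∈ after m L → after x (after m L) ≡ after x L
after-after {x} {m} {y ∷ ys} (y∉ys ∷ u) x∈ with y ≡ᵇ m
... | true  = sym (after-∷-≢ ys (All.lookup y∉ys x∈))
... | false = trans (after-after u x∈)
                    (sym (after-∷-≢ ys (All.lookup y∉ys (after-⊆ ys x∈))))

RightToLeftMaximum : List ℕ → ℕ → Set
RightToLeftMaximum L x = x ∈ L × All (_≤ x) (after x L)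

maxL-upper : ∀ L → All (_≤ maxL L) L
maxL-upper L = foldr-forcesᵇ {P = _≤ maxL L}
  (λ a b a⊔b≤ → m⊔n≤o⇒m≤o a b a⊔b≤ , m⊔n≤o⇒n≤o a b a⊔b≤) 0 L ≤-refl

maxL-∈ : ∀ y ys → maxL (y ∷ ys) ∈ y ∷ ys
maxL-∈ y ys with foldr-selective ⊔-sel 0 (y ∷ ys)
... | inj₂ max∈  = max∈
... | inj₁ max≡0 = here (trans max≡0 (sym (n≤0⇒n≡0 (subst (y ≤_) max≡0 (m≤m⊔n y (maxL ys))))))

RightToLeftMaximum-maxL : ∀ y ys → RightToLeftMaximum (y ∷ ys) (maxL (y ∷ ys))
RightToLeftMaximum-maxL y ys =
  maxL-∈ y ys , All.tabulate (All.lookup (maxL-upper (y ∷ ys)) ∘ after-⊆ (y ∷ ys))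

RightToLeftMaximum-after⁺ : ∀ m {L x} → Unique L →
  RightToLeftMaximum (after m L) x → RightToLeftMaximum L x
RightToLeftMaximum-after⁺ m {L} {x} u (x∈ , ≤x) =
  after-⊆ L x∈ , subst (All (_≤ x)) (after-after u x∈) ≤x

RightToLeftMaximum-maxL⁻ : ∀ {y ys x} → Unique (y ∷ ys) → RightToLeftMaximum (y ∷ ys) x →
  x ≡ maxL (y ∷ ys) ⊎ RightToLeftMaximum (after (maxL (y ∷ ys)) (y ∷ ys)) x
RightToLeftMaximum-maxL⁻ {y} {ys} {x} u (x∈ , ≤x) with x ≟ maxL (y ∷ ys)
... | yes x≡m = inj₁ x≡m
... | no  x≢m with ∈-after-either x∈ (maxL-∈ y ys) x≢m
...   | inj₁ x∈after = inj₂ (x∈after , subst (All (_≤ x)) (sym (after-after u x∈after)) ≤x)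
...   | inj₂ m∈after = contradiction
  (≤-antisym (All.lookup (maxL-upper (y ∷ ys)) x∈) (All.lookup ≤x m∈after)) x≢m

RightToLeftMaximum-here : ∀ {y ys} → All (_≤ y) ys → RightToLeftMaximum (y ∷ ys) y
RightToLeftMaximum-here {y} {ys} ≤y = here refl , subst (All (_≤ y)) (sym (after-∷-≡ y ys)) ≤y

RightToLeftMaximum-there : ∀ {y ys x} → Unique (y ∷ ys) →
  RightToLeftMaximum ys x → RightToLeftMaximum (y ∷ ys) x
RightToLeftMaximum-there {ys = ys} {x} (y∉ys ∷ _) (x∈ys , ≤x) =
  there x∈ys , subst (All (_≤ x)) (sym (after-∷-≢ ys (All.lookup y∉ys x∈ys))) ≤x

RightToLeftMaximum-∷⁻ : ∀ {y ys x} → Unique (y ∷ ys) → RightToLeftMaximum (y ∷ ys) x →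
  (x ≡ y × All (_≤ y) ys) ⊎ RightToLeftMaximum ys x
RightToLeftMaximum-∷⁻ {y} {ys} _ (here refl , ≤y) =
  inj₁ (refl , subst (All (_≤ y)) (after-∷-≡ y ys) ≤y)
RightToLeftMaximum-∷⁻ {y} {ys} {x} (y∉ys ∷ _) (there x∈ys , ≤x) =
  inj₂ (x∈ys , subst (All (_≤ x)) (after-∷-≢ ys (All.lookup y∉ys x∈ys)) ≤x)

∈-chainF⁻ : ∀ f {L x} → Unique L → x ∈ chainF f L → RightToLeftMaximum L x
∈-chainF⁻ (suc f) {y ∷ ys} u (here refl) = RightToLeftMaximum-maxL y ys
∈-chainF⁻ (suc f) {y ∷ ys} u (there x∈)  =
  RightToLeftMaximum-after⁺ _ u (∈-chainF⁻ f (Unique-after _ u) x∈)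

∈-chainF⁺ : ∀ f {L x} → length L ≤ f → Unique L → RightToLeftMaximum L x → x ∈ chainF f L
∈-chainF⁺ f       {[]}     _         _ (() , _)
∈-chainF⁺ (suc f) {y ∷ ys} (s≤s len) u r with RightToLeftMaximum-maxL⁻ u r
... | inj₁ refl = here refl
... | inj₂ r′   = there (∈-chainF⁺ f (≤-trans (length-after-∷ _ y ys) len) (Unique-after _ u) r′)

∈-chain⁻ : ∀ {L x} → Unique L → x ∈ chain L → RightToLeftMaximum L x
∈-chain⁻ {L} = ∈-chainF⁻ (length L)

∈-chain⁺ : ∀ {L x} → Unique L → RightToLeftMaximum L x → x ∈ chain L
∈-chain⁺ {L} = ∈-chainF⁺ (length L) ≤-refl

-- The stack algorithm

popWhileLess-++ : ∀ x out st →
  proj₁ (popWhileLess x out st) ++ proj₂ (popWhileLess x out st) ≡ out ++ st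
popWhileLess-++ x out []       = refl
popWhileLess-++ x out (t ∷ st) with t <ᵇ x
... | true  = trans (popWhileLess-++ x (out ++ [ t ]) st) (++-assoc out [ t ] st)
... | false = refl

popWhileLess-extends : ∀ x out st → ∃ λ o → proj₁ (popWhileLess x out st) ≡ out ++ o
popWhileLess-extends x out []       = [] , sym (++-identityʳ out)
popWhileLess-extends x out (t ∷ st) with t <ᵇ x
... | true  = let o , eq = popWhileLess-extends x (out ++ [ t ]) st
              in t ∷ o , trans eq (++-assoc out [ t ] o)
... | false = [] , sym (++-identityʳ out)

Sorted-head≤ : ∀ {t st z} → Sorted (t ∷ st) → z ∈ t ∷ st → t ≤ z
Sorted-head≤ sorted = All.lookup (Linked⇒All ≤-trans ≤-refl sorted)

∈-popWhileLess⁻ : ∀ {z} x out st → Sorted st →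
  z ∈ proj₂ (popWhileLess x out st) → z ∈ st × x ≤ z
∈-popWhileLess⁻ x out (t ∷ st) sorted z∈ with t <ᵇ x | <ᵇ-reflects-< t x
... | true  | _ =
  let z∈st , x≤z = ∈-popWhileLess⁻ x (out ++ [ t ]) st (Linked.tail sorted) z∈ in there z∈st , x≤z
... | false | ofⁿ t≮x = z∈ , ≤-trans (≮⇒≥ t≮x) (Sorted-head≤ sorted z∈)

∈-popWhileLess⁺ : ∀ {z} x out st → Sorted st →
  z ∈ st → x ≤ z → z ∈ proj₂ (popWhileLess x out st)
∈-popWhileLess⁺ x out (t ∷ st) sorted z∈ x≤z with t <ᵇ x | <ᵇ-reflects-< t x
... | false | _ = z∈
... | true  | ofʸ t<x with z∈
...   | here refl  = contradiction x≤z (<⇒≱ t<x)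
...   | there z∈st = ∈-popWhileLess⁺ x (out ++ [ t ]) st (Linked.tail sorted) z∈st x≤z

popWhileLess-Sorted : ∀ x out st → Sorted st → Sorted (x ∷ proj₂ (popWhileLess x out st))
popWhileLess-Sorted x out []       _      = [-]
popWhileLess-Sorted x out (t ∷ st) sorted with t <ᵇ x | <ᵇ-reflects-< t x
... | true  | _        = popWhileLess-Sorted x (out ++ [ t ]) st (Linked.tail sorted)
... | false | ofⁿ t≮x = ≮⇒≥ t≮x ∷ sorted

stackRun-↭ : ∀ xs st → stackRun xs st ↭ xs ++ st
stackRun-↭ []       st = ↭-refl
stackRun-↭ (x ∷ xs) st = begin
  out ++ stackRun xs (x ∷ st′) ↭⟨ ++⁺ˡ out (stackRun-↭ xs (x ∷ st′)) ⟩
  out ++ xs ++ x ∷ st′         ↭⟨ shifts out xs ⟩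
  xs ++ out ++ x ∷ st′         ↭⟨ ++⁺ˡ xs (shift x out st′) ⟩
  xs ++ x ∷ out ++ st′         ≡⟨ cong (λ t → xs ++ x ∷ t) (popWhileLess-++ x [] st) ⟩
  xs ++ x ∷ st                 ↭⟨ shift x xs st ⟩
  x ∷ xs ++ st                 ∎
  where
  open PermutationReasoning
  out = proj₁ (popWhileLess x [] st)
  st′ = proj₂ (popWhileLess x [] st)

s-↭ : ∀ σ → s σ ↭ σ
s-↭ σ = subst (s σ ↭_) (++-identityʳ σ) (stackRun-↭ σ [])

s^-↭ : ∀ i π → s^ i π ↭ π
s^-↭ zero    π = ↭-refl
s^-↭ (suc i) π = ↭-trans (s-↭ (s^ i π)) (s^-↭ i π)

stackRead : List ℕ → List ℕ → List ℕ × List ℕ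
stackRead []       st = [] , st
stackRead (x ∷ xs) st =
  let out  , st′ = popWhileLess x [] st
      out′ , st″ = stackRead xs (x ∷ st′)
  in  out ++ out′ , st″

stackRun-++ : ∀ xs zs st →
  stackRun (xs ++ zs) st ≡ proj₁ (stackRead xs st) ++ stackRun zs (proj₂ (stackRead xs st))
stackRun-++ []       zs st = refl
stackRun-++ (x ∷ xs) zs st =
  trans (cong (out ++_) (stackRun-++ xs zs (x ∷ st′))) (sym (++-assoc out _ _))
  where
  out = proj₁ (popWhileLess x [] st)
  st′ = proj₂ (popWhileLess x [] st)

stackRead-↭ : ∀ xs → proj₁ (stackRead xs []) ++ proj₂ (stackRead xs []) ↭ xs
stackRead-↭ xs = begin
  proj₁ (stackRead xs []) ++ proj₂ (stackRead xs []) ≡⟨ stackRun-++ xs [] [] ⟨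
  stackRun (xs ++ []) []                             ↭⟨ stackRun-↭ (xs ++ []) [] ⟩
  (xs ++ []) ++ []                                   ≡⟨ ++-identityʳ (xs ++ []) ⟩
  xs ++ []                                           ≡⟨ ++-identityʳ xs ⟩
  xs                                                 ∎
  where open PermutationReasoning

stackRead-output-⊆ : ∀ {x} xs → x ∈ proj₁ (stackRead xs []) → x ∈ xs
stackRead-output-⊆ xs = ∈-resp-↭ (stackRead-↭ xs) ∘ ∈-++⁺ˡ

∈-stackRead⁻ : ∀ {x} ys st → Sorted st → Unique ys → x ∈ proj₂ (stackRead ys st) →
  (x ∈ st × All (_≤ x) ys) ⊎ RightToLeftMaximum ys x
∈-stackRead⁻ []       st _      _  x∈ = inj₁ (x∈ , [])
∈-stackRead⁻ (y ∷ ys) st sorted u  x∈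
  with ∈-stackRead⁻ ys _ (popWhileLess-Sorted y [] st sorted) (AllPairs.tail u) x∈
... | inj₁ (here refl , ≤x)     = inj₂ (RightToLeftMaximum-here ≤x)
... | inj₁ (there x∈st′ , ≤x)   = let x∈st , y≤x = ∈-popWhileLess⁻ y [] st sorted x∈st′
                                  in inj₁ (x∈st , y≤x ∷ ≤x)
... | inj₂ r                    = inj₂ (RightToLeftMaximum-there u r)

∈-stackRead⁺ : ∀ {x} ys st → Sorted st → Unique ys →
  (x ∈ st × All (_≤ x) ys) ⊎ RightToLeftMaximum ys x → x ∈ proj₂ (stackRead ys st)
∈-stackRead⁺ []       st _      _ (inj₁ (x∈st , _)) = x∈st
∈-stackRead⁺ []       st _      _ (inj₂ (() , _))
∈-stackRead⁺ {x} (y ∷ ys) st sorted u h =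
  ∈-stackRead⁺ ys _ (popWhileLess-Sorted y [] st sorted) (AllPairs.tail u) (push-y h)
  where
  push-y : (x ∈ st × All (_≤ x) (y ∷ ys)) ⊎ RightToLeftMaximum (y ∷ ys) x →
    (x ∈ y ∷ proj₂ (popWhileLess y [] st) × All (_≤ x) ys) ⊎ RightToLeftMaximum ys x
  push-y (inj₁ (x∈st , y≤x ∷ ≤x)) = inj₁ (there (∈-popWhileLess⁺ y [] st sorted x∈st y≤x) , ≤x)
  push-y (inj₂ r) with RightToLeftMaximum-∷⁻ u r
  ... | inj₁ (refl , ≤y) = inj₁ (here refl , ≤y)
  ... | inj₂ r′          = inj₂ r′

-- Entries left of 0

leftOf0-++ : ∀ A B → 0 ∉ A → leftOf0 (A ++ 0 ∷ B) ≡ A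
leftOf0-++ []          B _   = refl
leftOf0-++ (zero  ∷ A) B 0∉ = contradiction (here refl) 0∉
leftOf0-++ (suc a ∷ A) B 0∉ = cong (suc a ∷_) (leftOf0-++ A B (0∉ ∘ there))

leftOf0-split : ∀ σ → 0 ∈ σ → ∃ λ R → σ ≡ leftOf0 σ ++ 0 ∷ R
leftOf0-split (zero  ∷ σ) _          = σ , refl
leftOf0-split (suc a ∷ σ) (there 0∈) = let R , eq = leftOf0-split σ 0∈ in R , cong (suc a ∷_) eq

0∉leftOf0 : ∀ σ → 0 ∉ leftOf0 σ
0∉leftOf0 (suc a ∷ σ) (there 0∈) = 0∉leftOf0 σ 0∈

leftOf0-⊆ : ∀ {x} σ → x ∈ leftOf0 σ → x ∈ σ
leftOf0-⊆ (suc a ∷ σ) (here refl) = here refl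
leftOf0-⊆ (suc a ∷ σ) (there x∈)  = there (leftOf0-⊆ σ x∈)

leftOf0-Increasing : ∀ σ → Increasing σ → 0 ∈ σ → leftOf0 σ ≡ []
leftOf0-Increasing (zero  ∷ σ)     _           _          = refl
leftOf0-Increasing (suc a ∷ [])    _           (there ())
leftOf0-Increasing (suc a ∷ b ∷ σ) (a<b ∷ inc) (there 0∈)
  with All.lookup (Linked⇒All <-trans a<b inc) 0∈
... | ()

stackRun-0-on-top : ∀ R st → ∃ λ r → stackRun R (0 ∷ st) ≡ 0 ∷ r
stackRun-0-on-top []          st = st , refl
stackRun-0-on-top (zero  ∷ R) st = stackRun-0-on-top R (0 ∷ st)
stackRun-0-on-top (suc a ∷ R) st =
  let o , eq = popWhileLess-extends (suc a) [ 0 ] st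
  in o ++ _ , cong (_++ stackRun R (suc a ∷ proj₂ (popWhileLess (suc a) [ 0 ] st))) eq

stackRun-0∷ : ∀ R st → ∃ λ r → stackRun (0 ∷ R) st ≡ 0 ∷ r
stackRun-0∷ R []       = stackRun-0-on-top R []
stackRun-0∷ R (t ∷ st) = stackRun-0-on-top R (t ∷ st)

leftOf0-s : ∀ σ → 0 ∈ σ → leftOf0 (s σ) ≡ proj₁ (stackRead (leftOf0 σ) [])
leftOf0-s σ 0∈σ = begin
  leftOf0 (s σ)                        ≡⟨ cong (leftOf0 ∘ s) σ≡ ⟩
  leftOf0 (stackRun (A ++ 0 ∷ R) [])   ≡⟨ cong leftOf0 (stackRun-++ A (0 ∷ R) []) ⟩
  leftOf0 (out ++ stackRun (0 ∷ R) st) ≡⟨ cong (leftOf0 ∘ (out ++_)) (proj₂ (stackRun-0∷ R st)) ⟩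
  leftOf0 (out ++ 0 ∷ _)               ≡⟨ leftOf0-++ out _ (0∉leftOf0 σ ∘ stackRead-output-⊆ A) ⟩
  out                                  ∎
  where
  open ≡-Reasoning
  A   = leftOf0 σ
  R   = proj₁ (leftOf0-split σ 0∈σ)
  σ≡  = proj₂ (leftOf0-split σ 0∈σ)
  out = proj₁ (stackRead A [])
  st  = proj₂ (stackRead A [])

module LeftOfZero {π : List ℕ} (π! : Unique π) (0∈π : 0 ∈ π) where

  L : ℕ → List ℕ
  L i = leftOf0 (s^ i π)

  0∈s^ : ∀ i → 0 ∈ s^ i π
  0∈s^ i = ∈-resp-↭ (↭-sym (s^-↭ i π)) 0∈π

  L-Unique : ∀ i → Unique (L i)
  L-Unique i = Unique-++⁻ˡ (L i) (subst Unique (proj₂ (leftOf0-split _ (0∈s^ i)))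
                 (Unique-resp-↭ (↭-sym (s^-↭ i π)) π!))

  L-suc : ∀ i → L (suc i) ≡ proj₁ (stackRead (L i) [])
  L-suc i = leftOf0-s (s^ i π) (0∈s^ i)

  L-suc-⊆ : ∀ i {x} → x ∈ L (suc i) → x ∈ L i
  L-suc-⊆ i = stackRead-output-⊆ (L i) ∘ subst (_ ∈_) (L-suc i)

  L-antitone : ∀ {i j x} → i ≤ j → x ∈ L j → x ∈ L i
  L-antitone = go ∘ ≤⇒≤′
    where
    go : ∀ {i j x} → i ≤′ j → x ∈ L j → x ∈ L i
    go ≤′-refl             = id
    go (≤′-step {j} i≤j) = go i≤j ∘ L-suc-⊆ j

  ∈-C⁻ : ∀ i {x} → x ∈ C π (suc i) → x ∈ L i × x ∉ L (suc i)
  ∈-C⁻ i x∈C =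
    proj₁ r , ∈-++-↭⇒∉ˡ (L-Unique i) (stackRead-↭ (L i)) x∈stack ∘ subst (_ ∈_) (L-suc i)
    where
    r = ∈-chain⁻ (L-Unique i) x∈C
    x∈stack = ∈-stackRead⁺ (L i) [] [] (L-Unique i) (inj₂ r)

  ∈-C⁺ : ∀ i {x} → x ∈ L i → x ∉ L (suc i) → x ∈ C π (suc i)
  ∈-C⁺ i x∈L x∉L′ with ∈-stackRead⁻ (L i) [] [] (L-Unique i)
                            (∈-++-↭⁺ʳ (stackRead-↭ (L i)) x∈L (x∉L′ ∘ subst (_ ∈_) (sym (L-suc i))))
  ... | inj₂ r = ∈-chain⁺ (L-Unique i) r

  C-disjoint-< : ∀ {i j x} → i < j → x ∈ C π (suc i) → x ∉ C π (suc j)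
  C-disjoint-< {i} {j} i<j x∈Cᵢ x∈Cⱼ =
    proj₂ (∈-C⁻ i x∈Cᵢ) (L-antitone i<j (proj₁ (∈-C⁻ j x∈Cⱼ)))

  C-disjoint : ∀ {i j x} → i ≢ j → x ∈ C π (suc i) → x ∉ C π (suc j)
  C-disjoint {i} {j} i≢j with <-cmp i j
  ... | tri< i<j _ _ = C-disjoint-< i<j
  ... | tri≈ _ i≡j _ = contradiction i≡j i≢j
  ... | tri> _ _ j<i = λ x∈Cᵢ x∈Cⱼ → C-disjoint-< j<i x∈Cⱼ x∈Cᵢ

  ∉-L-Increasing : ∀ k {x} → Increasing (s^ k π) → x ∉ L k
  ∉-L-Increasing k inc x∈ with subst (_ ∈_) (leftOf0-Increasing _ inc (0∈s^ k)) x∈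
  ... | ()

  C-⊆-L₀ : ∀ i {x} → x ∈ C π (suc i) → x ∈ L 0
  C-⊆-L₀ i = L-antitone (z≤n {i}) ∘ proj₁ ∘ ∈-C⁻ i

  L₀-⊆-C : ∀ {k x} → x ∈ L 0 → x ∉ L k → ∃ λ i → i < k × x ∈ C π (suc i)
  L₀-⊆-C {zero}  x∈L₀ x∉L₀ = contradiction x∈L₀ x∉L₀
  L₀-⊆-C {suc k} {x} x∈L₀ x∉L with x ∈? L k
  ... | yes x∈L = k , ≤-refl , ∈-C⁺ k x∈L x∉L
  ... | no  x∉L′ = let i , i<k , x∈C = L₀-⊆-C x∈L₀ x∉L′ in i , m<n⇒m<1+n i<k , x∈C

S′-Unique : ∀ {n π} → S′ n π → Unique π
S′-Unique {n} (π↭ , _) = Unique-resp-↭ (↭-sym π↭) (upTo⁺ (suc n))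

S′-0∈ : ∀ {n π} → S′ n π → 0 ∈ π
S′-0∈ (_ , τ , refl) = ∈-++⁺ʳ τ (here refl)

∈-leftOf0-S′⁻ : ∀ {n π x} → S′ n π → x ∈ leftOf0 π → 1 ≤ x × x ≤ n
∈-leftOf0-S′⁻ {π = π} (π↭ , _) x∈ =
  n≢0⇒n>0 (λ { refl → 0∉leftOf0 π x∈ }) , ≤-pred (∈-upTo⁻ (∈-resp-↭ π↭ (leftOf0-⊆ π x∈)))

∈-leftOf0-S′⁺ : ∀ {n π x} → S′ n π → 1 ≤ x × x ≤ n → x ∈ leftOf0 π
∈-leftOf0-S′⁺ {x = x} π∈S′@(π↭ , τ , refl) (1≤x , x≤n)
  with ∈-++⁻ τ (∈-resp-↭ (↭-sym π↭) (∈-upTo⁺ (s≤s x≤n)))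
... | inj₁ x∈τ       = subst (x ∈_) (sym (leftOf0-++ τ [] 0∉τ)) x∈τ
  where 0∉τ = λ 0∈τ → Unique-++⇒Disjoint τ (S′-Unique π∈S′) (0∈τ , here refl)
... | inj₂ (here refl) = contradiction 1≤x λ ()

corollary3p5 : (n : ℕ) (π : List ℕ) → S′ n π → (k : ℕ) → IsSC π k →
    ((i j : ℕ) → 1 ≤ i → i ≤ k → 1 ≤ j → j ≤ k → ¬ (i ≡ j) →
      (x : ℕ) → x ∈ C π i → x ∈ C π j → ⊥)
    × ((x : ℕ) → (Σ ℕ (λ i → (1 ≤ i × i ≤ k) × x ∈ C π i)) → (1 ≤ x × x ≤ n))
    × ((x : ℕ) → (1 ≤ x × x ≤ n) → Σ ℕ (λ i → (1 ≤ i × i ≤ k) × x ∈ C π i))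
corollary3p5 n π π∈S′ k (s^kπ-increasing , _) = disjoint , inside , covering
  where
  open LeftOfZero (S′-Unique π∈S′) (S′-0∈ π∈S′)

  disjoint : (i j : ℕ) → 1 ≤ i → i ≤ k → 1 ≤ j → j ≤ k → ¬ (i ≡ j) →
    (x : ℕ) → x ∈ C π i → x ∈ C π j → ⊥
  disjoint (suc i) (suc j) _ _ _ _ i≢j _ = C-disjoint (i≢j ∘ cong suc)

  inside : (x : ℕ) → Σ ℕ (λ i → (1 ≤ i × i ≤ k) × x ∈ C π i) → 1 ≤ x × x ≤ n
  inside x (suc i , _ , x∈C) = ∈-leftOf0-S′⁻ π∈S′ (C-⊆-L₀ i x∈C)

  covering : (x : ℕ) → 1 ≤ x × x ≤ n → Σ ℕ (λ i → (1 ≤ i × i ≤ k) × x ∈ C π i)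
  covering x x∈[n] with L₀-⊆-C (∈-leftOf0-S′⁺ π∈S′ x∈[n]) (∉-L-Increasing k s^kπ-increasing)
  ... | i , i<k , x∈C = suc i , (s≤s z≤n , i<k) , x∈C
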